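{- Let $c \geq 1$ and $t \geq 0$ be integers, let $G$ be a graph of matching width at least $t$, and let $Z$ be a $c$-NSOBDD computing $CNF(G)$. Then $|Z| \geq 2^{t/(2c-1)}$.
   Context: For a graph $G$, $CNF(G)$ has a variable $X_u$ for each vertex $u$ and a variable $X_{u,v}=X_{v,u}$ for each edge $\{u,v\}$; its clauses are $(X_u \vee X_{u,v} \vee X_v)$ for each edge $\{u,v\}$. Matching width: for a permutation $SV$ of $V(G)$ and a prefix $S_1$ of $SV$, the matching width of $S_1$ is the maximum size of a matching consisting of edges with one end in $S_1$ and the other in $V(G)\setminus S_1$; the matching width of $SV$ is the maximum over its prefixes; the matching width of $G$ is the minimum over all permutations of $V(G)$. A nondeterministic branching program is a directed acyclic graph with a single root and a single leaf, some of whose edges are labelled by literals. A path is consistent if it contains no two edges labelled by opposite literals of the same variable; $A(P)$ is the set of literals on a consistent path $P$. A computational path is a consistent root-leaf path. The program computes $F$ where an assignment $S$ (a set of literals) satisfies $F$ iff some computational path $P$ has $A(P)\subseteq S$. A sequence of literals is ordered according to a permutation $SV$ of the variables if the order of occurrence of any two variables agrees with $SV$. A $c$-NSOBDD is a nondeterministic branching program for which there is a permutation $SV$ of its variables such that every computational path $P$ can be written as a concatenation $P=P_1+\dots+P_c$ of consecutive subpaths (possibly single vertices) such that on each $P_i$ each variable labels at most one edge and the literals along $P_i$ are ordered according to $SV$. $|Z|$ denotes the number of nodes of $Z$. -}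

module Defs where

open import Data.Nat using (ℕ; zero; suc; _+_; _*_; _∸_; _^_; _≤_; _<_)
open import Data.Fin using (Fin; toℕ)
open import Data.Bool using (Bool; true; false; _∨_)
open import Data.Maybe using (Maybe; just; nothing)
open import Data.Sum using (_⊎_; inj₁; inj₂)
open import Data.Product using (Σ; ∃; ∃-syntax; _×_; _,_; proj₁; proj₂)
open import Data.List using (List; []; _∷_; length; concat; mapMaybe)
open import Data.List.Membership.Propositional using (_∈_)
open import Data.List.Relation.Unary.All using (All)
open import Data.List.Relation.Unary.AllPairs using (AllPairs)
open import Relation.Binary.PropositionalEquality using (_≡_; _≢_)
open import Relation.Nullary using (¬_)
open import Function.Bundles using (_⤖_; _⇔_; Bijection)

record Graph : Set where
  field
    nV   : ℕ
    mE   : ℕ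
    endA : Fin mE → Fin nV
    endB : Fin mE → Fin nV
    loopless : ∀ e → endA e ≢ endB e
    simple   : ∀ e f →
      ((endA e ≡ endA f × endB e ≡ endB f) ⊎ (endA e ≡ endB f × endB e ≡ endA f)) →
      e ≡ f
open Graph public

-- vertex v lies in the prefix of length i of the permutation whose
-- position map is pos
InPrefix : {n : ℕ} → (Fin n ⤖ Fin n) → ℕ → Fin n → Set
InPrefix pos i v = toℕ (Bijection.to pos v) < i

Crossing : (G : Graph) → (Fin (nV G) ⤖ Fin (nV G)) → ℕ → Fin (mE G) → Set
Crossing G pos i e =
  (InPrefix pos i (endA G e) × ¬ InPrefix pos i (endB G e)) ⊎
  (¬ InPrefix pos i (endA G e) × InPrefix pos i (endB G e))

Disjoint : (G : Graph) → Fin (mE G) → Fin (mE G) → Set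
Disjoint G e f =
  endA G e ≢ endA G f × endA G e ≢ endB G f ×
  endB G e ≢ endA G f × endB G e ≢ endB G f

CrossingMatching : (G : Graph) → (Fin (nV G) ⤖ Fin (nV G)) → ℕ → List (Fin (mE G)) → Set
CrossingMatching G pos i es = AllPairs (Disjoint G) es × All (Crossing G pos i) es

-- matching width of G is at least t:
-- min over permutations of max over prefixes of max crossing-matching size ≥ t
MatchingWidthAtLeast : Graph → ℕ → Set
MatchingWidthAtLeast G t =
  (pos : Fin (nV G) ⤖ Fin (nV G)) →
  ∃[ i ] (i ≤ nV G × ∃[ es ] (CrossingMatching G pos i es × t ≤ length es))

-- CNF(G): variables X_u (inj₁ u) and X_e (inj₂ e)

Var : Graph → Set
Var G = Fin (nV G) ⊎ Fin (mE G)

SatCNF : (G : Graph) → (Var G → Bool) → Set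
SatCNF G σ = ∀ e → (σ (inj₁ (endA G e)) ∨ σ (inj₂ e) ∨ σ (inj₁ (endB G e))) ≡ true

Lit : Set → Set
Lit X = X × Bool   -- (x , true) = x, (x , false) = ¬x

record BP (X : Set) : Set where
  field
    N     : ℕ
    M     : ℕ
    src   : Fin M → Fin N
    tgt   : Fin M → Fin N
    label : Fin M → Maybe (Lit X)  -- nothing = unlabelled edge
    root  : Fin N
    leaf  : Fin N
open BP public

data IsPath {X : Set} (Z : BP X) : Fin (N Z) → List (Fin (M Z)) → Fin (N Z) → Set where
  here : ∀ {a} → IsPath Z a [] a
  step : ∀ {a b e es} → src Z e ≡ a → IsPath Z (tgt Z e) es b → IsPath Z a (e ∷ es) b

record IsNBP {X : Set} (Z : BP X) : Set where
  field
    acyclic    : ∀ a es → IsPath Z a es a → es ≡ []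
    singleRoot : ∀ v → (¬ (∃[ e ] tgt Z e ≡ v)) ⇔ (v ≡ root Z)
    singleLeaf : ∀ v → (¬ (∃[ e ] src Z e ≡ v)) ⇔ (v ≡ leaf Z)

Labels : {X : Set} (Z : BP X) → List (Fin (M Z)) → List (Lit X)
Labels Z es = mapMaybe (label Z) es

Consistent : {X : Set} → List (Lit X) → Set
Consistent {X} ls = ∀ (x : X) b b' → (x , b) ∈ ls → (x , b') ∈ ls → b ≡ b'

ComputationalPath : {X : Set} (Z : BP X) → List (Fin (M Z)) → Set
ComputationalPath Z es = IsPath Z (root Z) es (leaf Z) × Consistent (Labels Z es)

-- A(P) ⊆ S where S is the set of literals true under σ
AgreesWith : {X : Set} → (X → Bool) → List (Lit X) → Set
AgreesWith σ ls = All (λ l → σ (proj₁ l) ≡ proj₂ l) ls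

Computes : {X : Set} (Z : BP X) → ((X → Bool) → Set) → Set
Computes {X} Z F = ∀ (σ : X → Bool) →
  F σ ⇔ (∃[ es ] (ComputationalPath Z es × AgreesWith σ (Labels Z es)))

-- literals occur with strictly increasing rank: each variable at most once
-- and ordered according to the permutation
OrderedBy : {X : Set} → (X → ℕ) → List (Lit X) → Set
OrderedBy rank ls = AllPairs (λ l l' → rank (proj₁ l) < rank (proj₁ l')) ls

-- c-NSOBDD over the variables of G (variable order = bijection Var G ⤖ Fin k)
IsCNSOBDD : (G : Graph) → ℕ → BP (Var G) → Set
IsCNSOBDD G c Z =
  IsNBP Z ×
  Σ (Var G ⤖ Fin (nV G + mE G)) λ SV →
    ∀ es → ComputationalPath Z es →
      ∃[ chunks ] (length chunks ≡ c × concat chunks ≡ es ×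
        All (λ ch → OrderedBy (λ x → toℕ (Bijection.to SV x)) (Labels Z ch)) chunks)

-- The variable order of Z induces an order on the vertices; by matching width some prefix of it
-- is crossed by a matching of t edges. Let L be the variables ranked below the end of that prefix.
-- Choosing for each matching edge which end is true gives 2^t satisfying assignments of CNF(G).
-- Each of the c ordered pieces of an accepting path reads L before its complement, so the path
-- alternates between L and its complement and crosses over at 2c - 1 nodes. If two assignments
-- crossed at the same nodes, splicing their paths would accept the assignment agreeing with the
-- first on L and with the second elsewhere; where the two choices differ on a matching edge, that
-- assignment falsifies the edge's clause. So the tuples of crossing nodes are pairwise distinct,
-- and 2^t <= |Z|^(2c - 1).

module Submission where

open import Defs
open import Data.Nat using (ℕ; zero; suc; _+_; _*_; _∸_; _^_; _≤_; _<_; _<?_; z≤n; s≤s; s<s⁻¹)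
open import Data.Nat.Properties
  using (≤-refl; ≤-trans; ≤-<-trans; <-≤-trans; <⇒≤; <⇒≱; <⇒≢; m≤n⇒m≤1+n; 1+n≰n; <-cmp; *-suc; ^-monoʳ-≤)
open import Data.Fin using (Fin; zero; suc; toℕ; fromℕ<; punchOut; funToFin; finToFun; _≟_)
import Data.Fin as Fin
open import Data.Fin.Properties
  using (any?; ¬∀⟶∃¬; injective⇒≤; punchOut-injective; toℕ-fromℕ<; fromℕ<-injective; toℕ-injective;
         funToFin-finToFin; finToFun-funToFin)
import Data.Fin.Properties as Fin
open import Data.Bool using (Bool; true; false; not; if_then_else_; _∨_)
open import Data.Bool.Properties using (∨-zeroʳ)
open import Data.Maybe using (just; nothing; maybe′)
open import Data.Vec using (Vec; []; _∷_; lookup; tabulate)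
open import Data.Vec.Properties using (tabulate∘lookup; tabulate-cong)
open import Data.List using (List; []; _∷_; length; concat; _++_; map)
import Data.List as List
open import Data.List.Properties using (mapMaybe-++; ++-identityʳ; ++-assoc)
open import Data.List.Membership.Propositional.Properties using (∈-lookup)
open import Data.List.Relation.Unary.All using (All; []; _∷_)
import Data.List.Relation.Unary.All as All
import Data.List.Relation.Unary.All.Properties as All
open import Data.List.Relation.Unary.AllPairs using (AllPairs; []; _∷_)
open import Data.Product using (∃; ∃₂; _×_; _,_; proj₁; proj₂)
open import Data.Sum using (_⊎_; inj₁; inj₂)
open import Data.Sum.Properties using (inj₁-injective)
open import Data.Empty using (⊥; ⊥-elim)
open import Function using (_∘_; id)
open import Function.Bundles using (_⤖_; mk⤖; Bijection; Equivalence)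
open import Function.Definitions using (Injective; Surjective)
open import Relation.Binary using (Tri; tri<; tri≈; tri>)
open import Relation.Nullary using (¬_; Dec; yes; no; does; contradiction)
open import Relation.Nullary.Decidable using (dec-true; dec-false)
open import Relation.Unary using (Decidable)
open import Relation.Binary.PropositionalEquality

injective⇒surjective : ∀ {n} {f : Fin n → Fin n} → Injective _≡_ _≡_ f → Surjective _≡_ _≡_ f
injective⇒surjective {zero} _ ()
injective⇒surjective {suc n} {f} f-injective y with any? (λ x → f x ≟ y)
... | yes (x , fx≡y) = x , λ { refl → fx≡y }
... | no y∉image = contradiction (injective⇒≤ {f = punched} punched-injective) 1+n≰n
  where
  y≢f : ∀ x → y ≢ f x
  y≢f x y≡fx = y∉image (x , sym y≡fx)
  punched : Fin (suc n) → Fin n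
  punched x = punchOut (y≢f x)
  punched-injective : Injective _≡_ _≡_ punched
  punched-injective = f-injective ∘ punchOut-injective (y≢f _) (y≢f _)

funToFin-cong : ∀ {m n} {f g : Fin m → Fin n} → (∀ i → f i ≡ g i) → funToFin f ≡ funToFin g
funToFin-cong {zero} _ = refl
funToFin-cong {suc m} f≗g = cong₂ Fin.combine (f≗g zero) (funToFin-cong (f≗g ∘ suc))

funToFin-injective : ∀ {m n} {f g : Fin m → Fin n} → funToFin f ≡ funToFin g → ∀ i → f i ≡ g i
funToFin-injective {f = f} {g} eq i =
  trans (sym (finToFun-funToFin f i)) (trans (cong (λ k → finToFun k i) eq) (finToFun-funToFin g i))

finToFun-injective : ∀ {m n} {k l : Fin (n ^ m)} →
                     (∀ i → finToFun {n} {m} k i ≡ finToFun l i) → k ≡ l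
finToFun-injective {m} {n} {k} {l} eq = begin
  k                              ≡⟨ funToFin-finToFin {m} {n} k ⟨
  funToFin (finToFun {n} {m} k)  ≡⟨ funToFin-cong eq ⟩
  funToFin (finToFun {n} {m} l)  ≡⟨ funToFin-finToFin {m} {n} l ⟩
  l                              ∎
  where open ≡-Reasoning

vecToFin : ∀ {n k} → Vec (Fin n) k → Fin (n ^ k)
vecToFin = funToFin ∘ lookup

vecToFin-injective : ∀ {n k} → Injective _≡_ _≡_ (vecToFin {n} {k})
vecToFin-injective {x = xs} {ys} eq = begin
  xs                 ≡⟨ tabulate∘lookup xs ⟨
  tabulate (lookup xs) ≡⟨ tabulate-cong (funToFin-injective eq) ⟩
  tabulate (lookup ys) ≡⟨ tabulate∘lookup ys ⟩
  ys                 ∎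
  where open ≡-Reasoning

allPairs-lookup : ∀ {A : Set} {R : A → A → Set} {xs} → AllPairs R xs →
                  ∀ {i j} → i Fin.< j → R (List.lookup xs i) (List.lookup xs j)
allPairs-lookup (Rx ∷ _)   {zero}  {suc j} _   = All.lookup Rx (∈-lookup j)
allPairs-lookup (_ ∷ Rxs)  {suc i} {suc j} i<j = allPairs-lookup Rxs (s<s⁻¹ i<j)

-- Ordering the vertices by rank: a vertex's position is the number of vertices of smaller rank.

countBelow : ∀ {n} → (Fin n → ℕ) → ℕ → ℕ
countBelow {zero} f r = 0
countBelow {suc n} f r with f zero <? r
... | yes _ = suc (countBelow (f ∘ suc) r)
... | no _ = countBelow (f ∘ suc) r

countBelow-mono : ∀ {n} (f : Fin n → ℕ) {r r′} → r ≤ r′ → countBelow f r ≤ countBelow f r′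
countBelow-mono {zero} f _ = z≤n
countBelow-mono {suc n} f {r} {r′} r≤r′ with f zero <? r | f zero <? r′
... | yes _ | yes _ = s≤s (countBelow-mono (f ∘ suc) r≤r′)
... | yes f₀<r | no f₀≮r′ = contradiction (<-≤-trans f₀<r r≤r′) f₀≮r′
... | no _ | yes _ = m≤n⇒m≤1+n (countBelow-mono (f ∘ suc) r≤r′)
... | no _ | no _ = countBelow-mono (f ∘ suc) r≤r′

countBelow-< : ∀ {n} (f : Fin n → ℕ) k {r r′} → r ≤ f k → f k < r′ → countBelow f r < countBelow f r′
countBelow-< {suc n} f k {r} {r′} r≤fk fk<r′ with f zero <? r | f zero <? r′ | k
... | yes f₀<r | _ | zero = contradiction r≤fk (<⇒≱ f₀<r)
... | no _ | yes _ | zero = s≤s (countBelow-mono (f ∘ suc) (≤-trans r≤fk (<⇒≤ fk<r′)))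
... | no _ | no f₀≮r′ | zero = contradiction fk<r′ f₀≮r′
... | yes _ | yes _ | suc k = s≤s (countBelow-< (f ∘ suc) k r≤fk fk<r′)
... | yes f₀<r | no f₀≮r′ | suc k = contradiction (<-≤-trans f₀<r (≤-trans r≤fk (<⇒≤ fk<r′))) f₀≮r′
... | no _ | yes _ | suc k = m≤n⇒m≤1+n (countBelow-< (f ∘ suc) k r≤fk fk<r′)
... | no _ | no _ | suc k = countBelow-< (f ∘ suc) k r≤fk fk<r′

countBelow-≤ : ∀ {n} (f : Fin n → ℕ) r → countBelow f r ≤ n
countBelow-≤ {zero} f r = z≤n
countBelow-≤ {suc n} f r with f zero <? r
... | yes _ = s≤s (countBelow-≤ (f ∘ suc) r)
... | no _ = m≤n⇒m≤1+n (countBelow-≤ (f ∘ suc) r)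

rankPosition : ∀ {n} (f : Fin n → ℕ) → Fin n → Fin n
rankPosition f v = fromℕ< (<-≤-trans (countBelow-< f v ≤-refl ≤-refl) (countBelow-≤ f _))

toℕ-rankPosition : ∀ {n} (f : Fin n → ℕ) v → toℕ (rankPosition f v) ≡ countBelow f (f v)
toℕ-rankPosition f v = toℕ-fromℕ< _

rankPosition-injective : ∀ {n} {f : Fin n → ℕ} → Injective _≡_ _≡_ f → Injective _≡_ _≡_ (rankPosition f)
rankPosition-injective {f = f} f-injective {x} {y} eq = by-comparison (<-cmp (f x) (f y))
  where
  same : countBelow f (f x) ≡ countBelow f (f y)
  same = fromℕ<-injective _ _ _ _ eq
  by-comparison : Tri (f x < f y) (f x ≡ f y) (f y < f x) → x ≡ y
  by-comparison (tri< fx<fy _ _) = contradiction same (<⇒≢ (countBelow-< f x ≤-refl fx<fy))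
  by-comparison (tri≈ _ fx≡fy _) = f-injective fx≡fy
  by-comparison (tri> _ _ fy<fx) = contradiction (sym same) (<⇒≢ (countBelow-< f y ≤-refl fy<fx))

rankOrder : ∀ {n} (f : Fin n → ℕ) → Injective _≡_ _≡_ f → Fin n ⤖ Fin n
rankOrder f f-injective =
  mk⤖ (rankPosition-injective f-injective , injective⇒surjective (rankPosition-injective f-injective))

alternate : ∀ {A : Set} → List A → List A → List A
alternate [] _ = []
alternate (x ∷ _) [] = x ∷ []
alternate (x ∷ xs) (_ ∷ ys) = x ∷ alternate ys xs

data Alternating {A : Set} (P Q : A → Set) : List A → Set where
  [] : Alternating P Q []
  _∷_ : ∀ {x xs} → P x → Alternating Q P xs → Alternating P Q (x ∷ xs)

alternate-alternating : ∀ {A : Set} {P Q P′ Q′ : A → Set} {xs ys} →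
  Alternating P Q xs → Alternating P′ Q′ ys → Alternating P Q′ (alternate xs ys)
alternate-alternating [] _ = []
alternate-alternating (px ∷ _) [] = px ∷ []
alternate-alternating (px ∷ pxs) (_ ∷ pys) = px ∷ alternate-alternating pys pxs

alternating⇒all : ∀ {A : Set} {P Q R : A → Set} {xs} →
  (∀ {x} → P x → R x) → (∀ {x} → Q x → R x) → Alternating P Q xs → All R xs
alternating⇒all _ _ [] = []
alternating⇒all P⇒R Q⇒R (px ∷ pxs) = P⇒R px ∷ alternating⇒all Q⇒R P⇒R pxs

agreesWith⇒consistent : ∀ {X : Set} {σ : X → Bool} {ls} → AgreesWith σ ls → Consistent ls
agreesWith⇒consistent agrees x b b′ xb∈ xb′∈ = trans (sym (All.lookup agrees xb∈)) (All.lookup agrees xb′∈)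

splice : ∀ {X : Set} {L : X → Set} → Decidable L → (X → Bool) → (X → Bool) → X → Bool
splice L? σ σ′ x = if does (L? x) then σ x else σ′ x

module _ {X : Set} {L : X → Set} (L? : Decidable L) (σ σ′ : X → Bool) where

  splice-inside : ∀ {x} → L x → splice L? σ σ′ x ≡ σ x
  splice-inside {x} x∈L with L? x
  ... | yes _ = refl
  ... | no x∉L = contradiction x∈L x∉L

  splice-outside : ∀ {x} → ¬ L x → splice L? σ σ′ x ≡ σ′ x
  splice-outside {x} x∉L with L? x
  ... | yes x∈L = contradiction x∈L x∉L
  ... | no _ = refl

  splice-both : ∀ {x b} → σ x ≡ b → σ′ x ≡ b → splice L? σ σ′ x ≡ b
  splice-both {x} σx≡b σ′x≡b with L? x
  ... | yes _ = σx≡b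
  ... | no _ = σ′x≡b

module _ {X : Set} (Z : BP X) where

  ++-isPath : ∀ {a m b xs ys} → IsPath Z a xs m → IsPath Z m ys b → IsPath Z a (xs ++ ys) b
  ++-isPath here q = q
  ++-isPath (step s p) q = step s (++-isPath p q)

  splitPath : ∀ {a b} xs {ys} → IsPath Z a (xs ++ ys) b → ∃ λ m → IsPath Z a xs m × IsPath Z m ys b
  splitPath [] p = _ , here , p
  splitPath (x ∷ xs) (step s p) = let m , p₁ , p₂ = splitPath xs p in m , step s p₁ , p₂

  infixr 5 _▹_

  data Segmented : ∀ {k} → Fin (N Z) → List (List (Fin (M Z))) → Vec (Fin (N Z)) k → Fin (N Z) → Set where
    last : ∀ {a s b} → IsPath Z a s b → Segmented a (s ∷ []) [] b
    _▹_ : ∀ {a s m ss k b} {ms : Vec _ k} →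
          IsPath Z a s m → Segmented m ss ms b → Segmented a (s ∷ ss) (m ∷ ms) b

  segment : ∀ {a b k} s ss → length ss ≡ k → IsPath Z a (concat (s ∷ ss)) b →
            ∃ λ (ms : Vec (Fin (N Z)) k) → Segmented a (s ∷ ss) ms b
  segment s [] refl p = [] , last (subst (λ es → IsPath Z _ es _) (++-identityʳ s) p)
  segment s (s′ ∷ ss) refl p =
    let m , p₁ , p₂ = splitPath s p
        ms , rest = segment s′ ss refl p₂
    in m ∷ ms , p₁ ▹ rest

  unsegment : ∀ {a b k ss} {ms : Vec _ k} → Segmented a ss ms b → IsPath Z a (concat ss) b
  unsegment (last p) = subst (λ es → IsPath Z _ es _) (sym (++-identityʳ _)) p
  unsegment (p ▹ rest) = ++-isPath p (unsegment rest)

  alternate-segmented : ∀ {a b k xs ys} {ms : Vec _ k} →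
    Segmented a xs ms b → Segmented a ys ms b → Segmented a (alternate xs ys) ms b
  alternate-segmented (last p) (last _) = last p
  alternate-segmented (p ▹ xs) (_ ▹ ys) = p ▹ alternate-segmented ys xs

  Labels-concat : ∀ ss → Labels Z (concat ss) ≡ concat (map (Labels Z) ss)
  Labels-concat [] = refl
  Labels-concat (s ∷ ss) =
    trans (mapMaybe-++ (label Z) s (concat ss)) (cong (Labels Z s ++_) (Labels-concat ss))

  module _ {σ : X → Bool} where

    agreesWith-concat⁺ : ∀ {ss} → All (AgreesWith σ ∘ Labels Z) ss → AgreesWith σ (Labels Z (concat ss))
    agreesWith-concat⁺ {ss} = subst (AgreesWith σ) (sym (Labels-concat ss)) ∘ All.concat⁺ ∘ All.map⁺

    agreesWith-concat⁻ : ∀ {ss} → AgreesWith σ (Labels Z (concat ss)) → All (AgreesWith σ ∘ Labels Z) ss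
    agreesWith-concat⁻ {ss} = All.map⁻ ∘ All.concat⁻ ∘ subst (AgreesWith σ) (Labels-concat ss)

  ReadsWithin : (X → Set) → (X → Bool) → List (Fin (M Z)) → Set
  ReadsWithin P σ s = All (λ l → P (proj₁ l) × σ (proj₁ l) ≡ proj₂ l) (Labels Z s)

  relabel : ∀ {R : Lit X → Set} {e m} es → label Z e ≡ m →
            All R (maybe′ _∷_ id m (Labels Z es)) → All R (Labels Z (e ∷ es))
  relabel _ refl r = r

-- Cut and paste along a fixed partition L of the variables.

module CutAndPaste {X : Set} (Z : BP X) {L : X → Set} (L? : Decidable L) where

  record AlternatingRun (σ : X → Bool) (k : ℕ) : Set where
    field
      segments : List (List (Fin (M Z)))
      crossings : Vec (Fin (N Z)) k
      segmented : Segmented Z (root Z) segments crossings (leaf Z)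
      alternating : Alternating (ReadsWithin Z L σ) (ReadsWithin Z (¬_ ∘ L) σ) segments
  open AlternatingRun

  cut-and-paste : ∀ {F σ σ′ k} → Computes Z F → (r : AlternatingRun σ k) (r′ : AlternatingRun σ′ k) →
                  crossings r ≡ crossings r′ → F (splice L? σ σ′)
  cut-and-paste {σ = σ} {σ′} computes r r′ same =
    Equivalence.from (computes (splice L? σ σ′))
      (concat pasted , (path , agreesWith⇒consistent agrees) , agrees)
    where
    pasted : List (List (Fin (M Z)))
    pasted = alternate (segments r) (segments r′)
    path : IsPath Z (root Z) (concat pasted) (leaf Z)
    path = unsegment Z (alternate-segmented Z (segmented r)
             (subst (λ ms → Segmented Z (root Z) (segments r′) ms (leaf Z)) (sym same) (segmented r′)))
    agrees : AgreesWith (splice L? σ σ′) (Labels Z (concat pasted))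
    agrees = agreesWith-concat⁺ Z (alternating⇒all
      (All.map λ (x∈L , σx≡b) → trans (splice-inside L? σ σ′ x∈L) σx≡b)
      (All.map λ (x∉L , σ′x≡b) → trans (splice-outside L? σ σ′ x∉L) σ′x≡b)
      (alternate-alternating (alternating r) (alternating r′)))

  fooling-set-bound : ∀ {F k m} → Computes Z F → (∀ {σ} → F σ → AlternatingRun σ k) →
    (σ : Fin m → X → Bool) → (∀ a → F (σ a)) →
    (∀ {a b} → a ≢ b → ¬ F (splice L? (σ a) (σ b)) ⊎ ¬ F (splice L? (σ b) (σ a))) →
    m ≤ N Z ^ k
  fooling-set-bound {F} {k} {m} computes run σ accepted fooled = injective⇒≤ {f = code} code-injective
    where
    code : Fin m → Fin (N Z ^ k)
    code a = vecToFin (crossings (run (accepted a)))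
    code-injective : Injective _≡_ _≡_ code
    code-injective {a} {b} eq with a ≟ b
    ... | yes a≡b = a≡b
    ... | no a≢b = ⊥-elim (spliced-accepted (fooled a≢b))
      where
      same : crossings (run (accepted a)) ≡ crossings (run (accepted b))
      same = vecToFin-injective eq
      spliced-accepted : ¬ (¬ F (splice L? (σ a) (σ b)) ⊎ ¬ F (splice L? (σ b) (σ a)))
      spliced-accepted (inj₁ rejected) =
        rejected (cut-and-paste computes (run (accepted a)) (run (accepted b)) same)
      spliced-accepted (inj₂ rejected) =
        rejected (cut-and-paste computes (run (accepted b)) (run (accepted a)) (sym same))

OrderedChunks : ∀ {X : Set} (Z : BP X) → (X → ℕ) → ℕ → List (Fin (M Z)) → Set
OrderedChunks Z rank c es =
  ∃ λ chunks → length chunks ≡ c × concat chunks ≡ es × All (OrderedBy rank ∘ Labels Z) chunks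

-- In a read-once ordered piece, the variables of a rank-downward-closed L come first.

module AlternatingRuns {X : Set} (Z : BP X) {L : X → Set} (L? : Decidable L)
  (rank : X → ℕ) (L-downward : ∀ {x y} → rank y < rank x → L x → L y) where

  open CutAndPaste Z L?

  SplitsAtCut : (X → Bool) → List (Fin (M Z)) → Set
  SplitsAtCut σ ch = ∃₂ λ front back →
    front ++ back ≡ ch × ReadsWithin Z L σ front × ReadsWithin Z (¬_ ∘ L) σ back

  prepend : ∀ {σ e ch} → (∀ front → ReadsWithin Z L σ front → ReadsWithin Z L σ (e ∷ front)) →
            SplitsAtCut σ ch → SplitsAtCut σ (e ∷ ch)
  prepend {e = e} extend (front , back , split , front-in , back-out) =
    e ∷ front , back , cong (e ∷_) split , extend front front-in , back-out

  splitChunk : ∀ σ ch → OrderedBy rank (Labels Z ch) → AgreesWith σ (Labels Z ch) → SplitsAtCut σ ch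
  splitChunk _ [] _ _ = [] , [] , refl , [] , []
  splitChunk σ (e ∷ es) ordered agrees with label Z e in eq
  splitChunk σ (e ∷ es) ordered agrees | nothing =
    prepend {σ} {e} {es} (λ front → relabel Z front eq) (splitChunk σ es ordered agrees)
  splitChunk σ (e ∷ es) (_ ∷ ordered) (σx≡b ∷ agrees) | just (x , b) with L? x
  ... | yes x∈L =
    prepend {σ} {e} {es} (λ front r → relabel Z front eq ((x∈L , σx≡b) ∷ r)) (splitChunk σ es ordered agrees)
  splitChunk σ (e ∷ es) (x<later ∷ _) (σx≡b ∷ agrees) | just (x , b) | no x∉L =
    [] , e ∷ es , refl , [] , relabel Z es eq ((x∉L , σx≡b) ∷ rest-outside)
    where
    later∉L : ∀ {l : Lit X} → rank x < rank (proj₁ l) → ¬ L (proj₁ l)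
    later∉L {l} x<y y∈L = x∉L (L-downward {proj₁ l} {x} x<y y∈L)
    rest-outside : ReadsWithin Z (¬_ ∘ L) σ es
    rest-outside = All.zip (All.map (λ {l} → later∉L {l}) x<later , agrees)

  splitChunks : ∀ {σ} chunks → All (OrderedBy rank ∘ Labels Z) chunks → All (AgreesWith σ ∘ Labels Z) chunks →
    ∃ λ segs → concat segs ≡ concat chunks × length segs ≡ 2 * length chunks ×
               Alternating (ReadsWithin Z L σ) (ReadsWithin Z (¬_ ∘ L) σ) segs
  splitChunks [] [] [] = [] , refl , refl , []
  splitChunks (ch ∷ chs) (ordered ∷ ordereds) (agrees ∷ agreess) =
    let front , back , split , front-in , back-out = splitChunk _ ch ordered agrees
        segs , concat≡ , length≡ , alternating = splitChunks chs ordereds agreess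
    in front ∷ back ∷ segs
     , trans (sym (++-assoc front back (concat segs))) (cong₂ _++_ split concat≡)
     , trans (cong (2 +_) length≡) (sym (*-suc 2 (length chs)))
     , front-in ∷ back-out ∷ alternating

  alternatingRun : ∀ {σ es c} → 1 ≤ c → IsPath Z (root Z) es (leaf Z) → AgreesWith σ (Labels Z es) →
                   OrderedChunks Z rank c es → AlternatingRun σ (2 * c ∸ 1)
  alternatingRun () _ _ ([] , refl , refl , _)
  alternatingRun _ path agrees (ch ∷ chs , refl , refl , ordered)
    with splitChunks (ch ∷ chs) ordered (agreesWith-concat⁻ Z agrees)
  ... | s ∷ ss , concat≡ , length≡ , alternating = record
    { segments = s ∷ ss ; crossings = proj₁ run ; segmented = proj₂ run ; alternating = alternating }
    where
    run = segment Z s ss (cong (_∸ 1) length≡) (subst (λ es → IsPath Z _ es _) (sym concat≡) path)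

  acceptingRun : ∀ {F c} → 1 ≤ c → Computes Z F →
                 (∀ es → ComputationalPath Z es → OrderedChunks Z rank c es) →
                 ∀ {σ} → F σ → AlternatingRun σ (2 * c ∸ 1)
  acceptingRun c≥1 computes chunked {σ} accepted =
    let es , computational , agrees = Equivalence.to (computes σ) accepted
    in alternatingRun c≥1 (proj₁ computational) agrees (chunked es computational)

module _ (G : Graph) where

  Incident : Fin (nV G) → Fin (mE G) → Set
  Incident v e = v ≡ endA G e ⊎ v ≡ endB G e

  disjoint⇒¬commonEnd : ∀ {e f v} → Disjoint G e f → Incident v e → Incident v f → ⊥
  disjoint⇒¬commonEnd (A≢A , _ , _ , _) (inj₁ refl) (inj₁ v≡A) = A≢A v≡A
  disjoint⇒¬commonEnd (_ , A≢B , _ , _) (inj₁ refl) (inj₂ v≡B) = A≢B v≡B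
  disjoint⇒¬commonEnd (_ , _ , B≢A , _) (inj₂ refl) (inj₁ v≡A) = B≢A v≡A
  disjoint⇒¬commonEnd (_ , _ , _ , B≢B) (inj₂ refl) (inj₂ v≡B) = B≢B v≡B

  data Cut (U : Fin (nV G) → Set) (e : Fin (mE G)) : Set where
    endA-inside : U (endA G e) → ¬ U (endB G e) → Cut U e
    endB-inside : ¬ U (endA G e) → U (endB G e) → Cut U e

  module _ {U : Fin (nV G) → Set} {e : Fin (mE G)} where

    inside outside : Cut U e → Fin (nV G)
    inside (endA-inside _ _) = endA G e
    inside (endB-inside _ _) = endB G e
    outside (endA-inside _ _) = endB G e
    outside (endB-inside _ _) = endA G e

    inside∈U : (cut : Cut U e) → U (inside cut)
    inside∈U (endA-inside A∈U _) = A∈U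
    inside∈U (endB-inside _ B∈U) = B∈U

    outside∉U : (cut : Cut U e) → ¬ U (outside cut)
    outside∉U (endA-inside _ B∉U) = B∉U
    outside∉U (endB-inside A∉U _) = A∉U

    chosenEnd : Fin 2 → Cut U e → Fin (nV G)
    chosenEnd zero = inside
    chosenEnd (suc zero) = outside

    chosenEnd-incident : ∀ b (cut : Cut U e) → Incident (chosenEnd b cut) e
    chosenEnd-incident zero (endA-inside _ _) = inj₁ refl
    chosenEnd-incident zero (endB-inside _ _) = inj₂ refl
    chosenEnd-incident (suc zero) (endA-inside _ _) = inj₂ refl
    chosenEnd-incident (suc zero) (endB-inside _ _) = inj₁ refl

-- Every way of choosing one end of each edge of a cut matching gives a satisfying assignment of
-- CNF(G); splicing two different choices falsifies the clause of an edge where they differ.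

module CutMatching (G : Graph) {L : Var G → Set} (L? : Decidable L) (ms : List (Fin (mE G)))
  (ms-disjoint : AllPairs (Disjoint G) ms) (ms-cut : All (Cut G (L ∘ inj₁)) ms) where

  edge : Fin (length ms) → Fin (mE G)
  edge = List.lookup ms

  edge-cut : ∀ j → Cut G (L ∘ inj₁) (edge j)
  edge-cut j = All.lookup ms-cut (∈-lookup j)

  matched-unique : ∀ {v i j} → Incident G v (edge i) → Incident G v (edge j) → i ≡ j
  matched-unique {i = i} {j} v∈i v∈j with Fin.<-cmp i j
  ... | tri< i<j _ _ = ⊥-elim (disjoint⇒¬commonEnd G (allPairs-lookup ms-disjoint i<j) v∈i v∈j)
  ... | tri≈ _ i≡j _ = i≡j
  ... | tri> _ _ j<i = ⊥-elim (disjoint⇒¬commonEnd G (allPairs-lookup ms-disjoint j<i) v∈j v∈i)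

  Choice : Set
  Choice = Fin (length ms) → Fin 2

  trueEnd : Choice → Fin (length ms) → Fin (nV G)
  trueEnd b j = chosenEnd G (b j) (edge-cut j)

  trueEnd-incident : ∀ b j → Incident G (trueEnd b j) (edge j)
  trueEnd-incident b j = chosenEnd-incident G (b j) (edge-cut j)

  assignment : Choice → Var G → Bool
  assignment b (inj₁ v) = does (any? λ j → trueEnd b j ≟ v)
  assignment b (inj₂ e) = not (does (any? λ j → edge j ≟ e))

  assignment-trueEnd : ∀ b j → assignment b (inj₁ (trueEnd b j)) ≡ true
  assignment-trueEnd b j = dec-true (any? λ j′ → trueEnd b j′ ≟ trueEnd b j) (j , refl)

  assignment-satisfies : ∀ b → SatCNF G (assignment b)
  assignment-satisfies b e with any? (λ j → edge j ≟ e)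
  ... | no _ = ∨-zeroʳ _
  ... | yes (j , refl) with trueEnd b j | trueEnd-incident b j | assignment-trueEnd b j
  ...   | _ | inj₁ refl | isTrue rewrite isTrue = refl
  ...   | _ | inj₂ refl | isTrue rewrite isTrue = ∨-zeroʳ _

  assignment-vertex-false : ∀ b {v j} → Incident G v (edge j) → v ≢ trueEnd b j →
                            assignment b (inj₁ v) ≡ false
  assignment-vertex-false b {v} {j} v∈j v≢trueEnd = dec-false (any? λ j′ → trueEnd b j′ ≟ v) λ where
    (j′ , trueEnd≡v) →
      let j′≡j = matched-unique (subst (λ w → Incident G w (edge j′)) trueEnd≡v (trueEnd-incident b j′)) v∈j
      in v≢trueEnd (subst (λ i → v ≡ trueEnd b i) j′≡j (sym trueEnd≡v))

  assignment-edge-false : ∀ b j → assignment b (inj₂ (edge j)) ≡ false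
  assignment-edge-false b j = cong not (dec-true (any? λ j′ → edge j′ ≟ edge j) (j , refl))

  -- On L the splice follows b, which made the outside end of edge j true and so its inside end
  -- false; off L it follows b′, which made the inside end true and so the outside end false.
  splice-falsifies : ∀ b b′ {j} → b j ≡ suc zero → b′ j ≡ zero →
                     ¬ SatCNF G (splice L? (assignment b) (assignment b′))
  splice-falsifies b b′ {j} bj≡1 b′j≡0 sat =
    contradiction (trans (sym clause-false) (sat (edge j))) λ ()
    where
    τ = splice L? (assignment b) (assignment b′)
    b-picks-outside : trueEnd b j ≡ outside G (edge-cut j)
    b-picks-outside = cong (λ β → chosenEnd G β (edge-cut j)) bj≡1
    b′-picks-inside : trueEnd b′ j ≡ inside G (edge-cut j)
    b′-picks-inside = cong (λ β → chosenEnd G β (edge-cut j)) b′j≡0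
    end-false : ∀ {v} → Incident G v (edge j) → τ (inj₁ v) ≡ false
    end-false {v} v∈j = bySide (L? (inj₁ v))
      where
      bySide : Dec (L (inj₁ v)) → τ (inj₁ v) ≡ false
      bySide (yes v∈L) = trans (splice-inside L? (assignment b) (assignment b′) v∈L)
        (assignment-vertex-false b v∈j λ v≡end →
          outside∉U G (edge-cut j) (subst (L ∘ inj₁) (trans v≡end b-picks-outside) v∈L))
      bySide (no v∉L) = trans (splice-outside L? (assignment b) (assignment b′) v∉L)
        (assignment-vertex-false b′ v∈j λ v≡end →
          v∉L (subst (L ∘ inj₁) (sym (trans v≡end b′-picks-inside)) (inside∈U G (edge-cut j))))
    edge-false : τ (inj₂ (edge j)) ≡ false
    edge-false =
      splice-both L? (assignment b) (assignment b′) (assignment-edge-false b j) (assignment-edge-false b′ j)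
    clause-false : τ (inj₁ (endA G (edge j))) ∨ τ (inj₂ (edge j)) ∨ τ (inj₁ (endB G (edge j))) ≡ false
    clause-false = cong₂ _∨_ (end-false (inj₁ refl)) (cong₂ _∨_ edge-false (end-false (inj₂ refl)))

  bits : Fin (2 ^ length ms) → Choice
  bits = finToFun

  fooled : ∀ {k l} → k ≢ l →
    ¬ SatCNF G (splice L? (assignment (bits k)) (assignment (bits l))) ⊎
    ¬ SatCNF G (splice L? (assignment (bits l)) (assignment (bits k)))
  fooled {k} {l} k≢l with ¬∀⟶∃¬ _ _ (λ j → bits k j ≟ bits l j) (k≢l ∘ finToFun-injective)
  ... | j , bits-differ with bits k j in kj | bits l j in lj
  ...   | zero | zero = contradiction refl bits-differ
  ...   | zero | suc zero = inj₂ (splice-falsifies (bits l) (bits k) lj kj)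
  ...   | suc zero | zero = inj₁ (splice-falsifies (bits k) (bits l) kj lj)
  ...   | suc zero | suc zero = contradiction refl bits-differ

-- Below i: the variables ranked below the i-th vertex of the vertex order induced by rank.

module VariableOrder (G : Graph) (rank : Var G → ℕ) (rank-injective : Injective _≡_ _≡_ rank) where

  vertexOrder : Fin (nV G) ⤖ Fin (nV G)
  vertexOrder = rankOrder (rank ∘ inj₁) (inj₁-injective ∘ rank-injective)

  Below : ℕ → Var G → Set
  Below i x = countBelow (rank ∘ inj₁) (rank x) < i

  Below? : ∀ i → Decidable (Below i)
  Below? i x = countBelow (rank ∘ inj₁) (rank x) <? i

  module PrefixIsBelow (i : ℕ) {v : Fin (nV G)} where
    inPrefix⇒below : InPrefix vertexOrder i v → Below i (inj₁ v)
    inPrefix⇒below = subst (_< i) (toℕ-rankPosition (rank ∘ inj₁) v)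

    below⇒inPrefix : Below i (inj₁ v) → InPrefix vertexOrder i v
    below⇒inPrefix = subst (_< i) (sym (toℕ-rankPosition (rank ∘ inj₁) v))

  Below-downward : ∀ {i x y} → rank y < rank x → Below i x → Below i y
  Below-downward y<x = ≤-<-trans (countBelow-mono (rank ∘ inj₁) (<⇒≤ y<x))

  crossing⇒cut : ∀ {i e} → Crossing G vertexOrder i e → Cut G (Below i ∘ inj₁) e
  crossing⇒cut {i} = λ where
      (inj₁ (A∈ , B∉)) → endA-inside (inPrefix⇒below A∈) (B∉ ∘ below⇒inPrefix)
      (inj₂ (A∉ , B∈)) → endB-inside (A∉ ∘ below⇒inPrefix) (inPrefix⇒below B∈)
    where open PrefixIsBelow i

  matching-bound : ∀ {c i ms} → 1 ≤ c → (Z : BP (Var G)) → Computes Z (SatCNF G) →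
    (∀ es → ComputationalPath Z es → OrderedChunks Z rank c es) →
    CrossingMatching G vertexOrder i ms → 2 ^ length ms ≤ N Z ^ (2 * c ∸ 1)
  matching-bound {i = i} {ms} c≥1 Z computes chunked (disjoint , crossing) =
    fooling-set-bound computes (acceptingRun c≥1 computes chunked)
      (assignment ∘ bits) (assignment-satisfies ∘ bits) fooled
    where
    open CutAndPaste Z (Below? i)
    open AlternatingRuns Z (Below? i) rank Below-downward
    open CutMatching G (Below? i) ms disjoint (All.map crossing⇒cut crossing)

theorem4 : (c t : ℕ) → 1 ≤ c → (G : Graph) → MatchingWidthAtLeast G t →
    (Z : BP (Var G)) → IsCNSOBDD G c Z → Computes Z (SatCNF G) →
    2 ^ t ≤ N Z ^ (2 * c ∸ 1)
theorem4 c t c≥1 G width Z (_ , SV , chunked) computes =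
  let i , _ , ms , matching , t≤|ms| = width vertexOrder
  in ≤-trans (^-monoʳ-≤ 2 t≤|ms|) (matching-bound c≥1 Z computes chunked matching)
  where
  open VariableOrder G (λ x → toℕ (Bijection.to SV x)) (Bijection.injective SV ∘ toℕ-injective)
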